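{- For every $n\ge1$, the poset $\mathcal{D}(n)$ (equivalently, the set of hyperbinary partitions of $n$ ordered by refinement) is a distributive lattice.
   Context: A hyperbinary partition of $n$ is a partition into powers of $2$ in which each part occurs at most twice. Refinement: $\mu\le\lambda$ if the parts of $\lambda$ can be subdivided to produce the parts of $\mu$. With $\beta(n)=b_1\cdots b_k$ the binary expansion, a hyperbinary expansion of $n$ is a word $d_1\cdots d_k$ over $\{0,1,2\}$ with $\sum_id_i2^{k-i}=n$, identified with the hyperbinary partition in which $2^{k-i}$ has multiplicity $d_i$; $\mathcal{D}(n)$ carries the transported refinement order. -}

module Defs where

open import Data.Nat using (ℕ; zero; suc; _+_; _*_; _^_; _≡ᵇ_)
open import Data.Nat.Base using (⌊_/2⌋)
open import Data.Fin using (Fin; toℕ)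
open import Data.Vec using (Vec; []; _∷_)
open import Data.List using (List; []; _∷_; _++_; replicate; concat; map)
open import Data.Nat.ListAction using (sum)
open import Data.Product using (Σ; ∃; _×_; proj₁)
open import Data.List.Relation.Binary.Permutation.Propositional using (_↭_)
open import Relation.Binary.PropositionalEquality using (_≡_)

-- Length of the binary expansion β(n) = b₁⋯b_k of n (k = 0 for n = 0).
-- Computed with fuel n (the number of halvings never exceeds n).
bitLengthAux : ℕ → ℕ → ℕ
bitLengthAux zero    _       = 0
bitLengthAux (suc f) zero    = 0
bitLengthAux (suc f) (suc m) = suc (bitLengthAux f ⌊ suc m /2⌋)

bitLength : ℕ → ℕ
bitLength n = bitLengthAux n n

-- A word d₁⋯d_k over {0,1,2}; digits are Fin 3, d₁ is the head.
Word : ℕ → Set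
Word k = Vec (Fin 3) k

value : ∀ {k} → Word k → ℕ
value {zero}  []       = 0
value {suc k} (d ∷ ds) = toℕ d * 2 ^ k + value ds

-- The hyperbinary partition identified with the word: 2^{k-i} with multiplicity d_i.
parts : ∀ {k} → Word k → List ℕ
parts {zero}  []       = []
parts {suc k} (d ∷ ds) = replicate (toℕ d) (2 ^ k) ++ parts ds

D : ℕ → Set
D n = Σ (Word (bitLength n)) (λ w → value w ≡ n)

-- Refinement of partitions (as multisets of parts): μ ≤ λ iff the parts of μ
-- can be grouped into blocks whose sums are exactly the parts of λ, i.e. the
-- parts of λ can be subdivided to produce the parts of μ.
_refines_ : List ℕ → List ℕ → Set
μ refines λ′ = ∃ λ (blocks : List (List ℕ)) →
  (concat blocks ↭ μ) × (map sum blocks ↭ λ′)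

_≤D_ : ∀ {n} → D n → D n → Set
x ≤D y = parts (proj₁ x) refines parts (proj₁ y)

_≈D_ : ∀ {n} → D n → D n → Set
x ≈D y = proj₁ x ≡ proj₁ y

-- Describe a hyperbinary expansion d₁⋯d_k by its suffix values, the values of the words
-- dᵢ⋯d_k. A refinement can only increase, for every threshold T, the sum of the parts below T,
-- and for an expansion the sum of the parts below 2^(k-i+1) is its i-th suffix value.
-- Conversely, if the suffix values of x dominate those of y, the parts of x can be grouped
-- greedily, from the top digit down, into the parts of y. So 𝒟(n) order-embeds into (ℕ^k, ≥).
-- For two expansions of n the i-th suffix values are equal or differ by exactly 2^(k-i+1);
-- using this, one builds expansions realising their pointwise minimum and maximum. Hence 𝒟(n)
-- is a sublattice of the distributive lattice ℕ^k.
module Submission where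

open import Defs
open import Data.Nat using (ℕ; zero; suc; _+_; _*_; _^_; _≤_; _<_; _≥_; _⊓_; _⊔_; z≤n; s≤s; _<?_)
open import Data.Nat.Properties
open import Data.Nat.ListAction using (sum)
open import Data.Nat.ListAction.Properties using (sum-++; sum-↭)
open import Data.Nat.Solver using (module +-*-Solver)
open import Data.Fin using (Fin; toℕ)
open import Data.Fin.Properties using (toℕ-injective; toℕ≤pred[n])
open import Data.Vec using (Vec; []; _∷_; zipWith)
open import Data.Vec.Properties using (∷-injective)
import Data.Vec.Relation.Binary.Pointwise.Inductive as Pointwise
open Pointwise using (Pointwise; []; _∷_; Pointwise-≡⇒≡; ≡⇒Pointwise-≡)
open import Data.List using (List; []; _∷_; _++_; [_]; replicate; concat; map; filter)
open import Data.List.Properties using (filter-++; filter-all; filter-none; filter-accept; filter-reject)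
open import Data.List.Relation.Unary.All as All using (All; []; _∷_)
open import Data.List.Relation.Unary.All.Properties using (++⁺; replicate⁺)
open import Data.List.Relation.Binary.Permutation.Propositional
  using (_↭_; ↭-refl; ↭-trans; ↭-reflexive; prep)
open import Data.List.Relation.Binary.Permutation.Propositional.Properties using (++⁺ˡ; shifts; filter-↭)
open import Data.Product using (Σ; ∃₂; _×_; _,_; proj₁)
open import Data.Product.Relation.Binary.Lex.Strict using (×-Lex; ×-total₂)
open import Data.Sum using (_⊎_; inj₁; inj₂)
open import Algebra.Core using (Op₂)
open import Algebra.Lattice.Structures using () renaming (IsLattice to IsAlgLattice)
open import Relation.Nullary using (yes; no; contradiction)
open import Relation.Binary.Core using (Rel)
open import Relation.Binary.Definitions using (Total; Antisymmetric)
open import Relation.Binary.Lattice.Definitions using (Supremum; Infimum)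
open import Relation.Binary.Lattice.Structures using (IsDistributiveLattice)
open import Relation.Binary.Lattice.Bundles using (Lattice)
import Relation.Binary.Lattice.Properties.Lattice as LatticeProperties
open import Relation.Binary.Morphism.Structures using (IsOrderMonomorphism)
import Relation.Binary.Morphism.OrderMonomorphism as OrderMonomorphism
open import Relation.Binary.Properties.Poset ≤-poset using (≥-isPartialOrder)
import Relation.Binary.Reasoning.Setoid as SetoidReasoning
open import Relation.Binary.PropositionalEquality hiding ([_])

module _ {a ℓ₁ ℓ₂} {A : Set a} {_≈_ : Rel A ℓ₁} {_≤_ : Rel A ℓ₂} {_∨_ _∧_ : Op₂ A}
         (L : IsDistributiveLattice _≈_ _≤_ _∨_ _∧_) where

  private module L = IsDistributiveLattice L

  zipWith-supremum : ∀ {n} → Supremum (Pointwise _≤_ {n} {n}) (zipWith _∨_)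
  zipWith-supremum [] [] = [] , [] , λ { [] [] [] → [] }
  zipWith-supremum (x ∷ xs) (y ∷ ys) with L.supremum x y | zipWith-supremum xs ys
  ... | x≤ , y≤ , least | xs≤ , ys≤ , leasts = x≤ ∷ xs≤ , y≤ ∷ ys≤ , λ where
    (z ∷ zs) (x≤z ∷ xs≤zs) (y≤z ∷ ys≤zs) → least z x≤z y≤z ∷ leasts zs xs≤zs ys≤zs

  zipWith-infimum : ∀ {n} → Infimum (Pointwise _≤_ {n} {n}) (zipWith _∧_)
  zipWith-infimum [] [] = [] , [] , λ { [] [] [] → [] }
  zipWith-infimum (x ∷ xs) (y ∷ ys) with L.infimum x y | zipWith-infimum xs ys
  ... | ≤x , ≤y , greatest | ≤xs , ≤ys , greatests = ≤x ∷ ≤xs , ≤y ∷ ≤ys , λ where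
    (z ∷ zs) (z≤x ∷ zs≤xs) (z≤y ∷ zs≤ys) → greatest z z≤x z≤y ∷ greatests zs zs≤xs zs≤ys

  Pointwise-antisym : ∀ {n} → Antisymmetric (Pointwise _≈_ {n} {n}) (Pointwise _≤_)
  Pointwise-antisym [] [] = []
  Pointwise-antisym (x≤y ∷ xs≤ys) (y≤x ∷ ys≤xs) = L.antisym x≤y y≤x ∷ Pointwise-antisym xs≤ys ys≤xs

  zipWith-distribˡ : ∀ {n} (xs ys zs : Vec A n) →
    Pointwise _≈_ (zipWith _∧_ xs (zipWith _∨_ ys zs))
                  (zipWith _∨_ (zipWith _∧_ xs ys) (zipWith _∧_ xs zs))
  zipWith-distribˡ [] [] [] = []
  zipWith-distribˡ (x ∷ xs) (y ∷ ys) (z ∷ zs) = L.∧-distribˡ-∨ x y z ∷ zipWith-distribˡ xs ys zs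

  Pointwise-isDistributiveLattice : ∀ n →
    IsDistributiveLattice (Pointwise _≈_ {n} {n}) (Pointwise _≤_) (zipWith _∨_) (zipWith _∧_)
  Pointwise-isDistributiveLattice n = record
    { isLattice = record
      { isPartialOrder = record
        { isPreorder = record
          { isEquivalence = Pointwise.isEquivalence L.isEquivalence n
          ; reflexive     = Pointwise.map L.reflexive
          ; trans         = Pointwise.trans L.trans
          }
        ; antisym = Pointwise-antisym
        }
      ; supremum = zipWith-supremum
      ; infimum  = zipWith-infimum
      }
    ; ∧-distribˡ-∨ = zipWith-distribˡ
    }

module _ {a b ℓ₁ ℓ₂ ℓ₃ ℓ₄} {A : Set a} {B : Set b}
         {_≈₁_ : Rel A ℓ₁} {_≈₂_ : Rel B ℓ₂} {_≲₁_ : Rel A ℓ₃} {_≲₂_ : Rel B ℓ₄}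
         {_∨₁_ _∧₁_ : Op₂ A} {_∨₂_ _∧₂_ : Op₂ B} {⟦_⟧ : A → B} where

  pullback-isDistributiveLattice :
    IsOrderMonomorphism _≈₁_ _≈₂_ _≲₁_ _≲₂_ ⟦_⟧ →
    (∀ x y → ⟦ x ∨₁ y ⟧ ≈₂ (⟦ x ⟧ ∨₂ ⟦ y ⟧)) →
    (∀ x y → ⟦ x ∧₁ y ⟧ ≈₂ (⟦ x ⟧ ∧₂ ⟦ y ⟧)) →
    IsDistributiveLattice _≈₂_ _≲₂_ _∨₂_ _∧₂_ →
    IsDistributiveLattice _≈₁_ _≲₁_ _∨₁_ _∧₁_
  pullback-isDistributiveLattice mono ∨-homo ∧-homo L = record
    { isLattice = record
      { isPartialOrder = OrderMonomorphism.isPartialOrder mono L.isPartialOrder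
      ; supremum       = supremum
      ; infimum        = infimum
      }
    ; ∧-distribˡ-∨ = λ x y z → M.injective (begin
        ⟦ x ∧₁ (y ∨₁ z) ⟧                   ≈⟨ ∧-homo x (y ∨₁ z) ⟩
        ⟦ x ⟧ ∧₂ ⟦ y ∨₁ z ⟧                 ≈⟨ P.∧-cong L.Eq.refl (∨-homo y z) ⟩
        ⟦ x ⟧ ∧₂ (⟦ y ⟧ ∨₂ ⟦ z ⟧)           ≈⟨ L.∧-distribˡ-∨ ⟦ x ⟧ ⟦ y ⟧ ⟦ z ⟧ ⟩
        (⟦ x ⟧ ∧₂ ⟦ y ⟧) ∨₂ (⟦ x ⟧ ∧₂ ⟦ z ⟧) ≈⟨ P.∨-cong (L.Eq.sym (∧-homo x y)) (L.Eq.sym (∧-homo x z)) ⟩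
        ⟦ x ∧₁ y ⟧ ∨₂ ⟦ x ∧₁ z ⟧            ≈⟨ L.Eq.sym (∨-homo (x ∧₁ y) (x ∧₁ z)) ⟩
        ⟦ (x ∧₁ y) ∨₁ (x ∧₁ z) ⟧            ∎)
    }
    where
    module M = IsOrderMonomorphism mono
    module L = IsDistributiveLattice L

    lattice : Lattice b ℓ₂ ℓ₄
    lattice = record { isLattice = L.isLattice }

    module P = IsAlgLattice (LatticeProperties.isAlgLattice lattice)
    open SetoidReasoning (Lattice.setoid lattice)

    supremum : Supremum _≲₁_ _∨₁_
    supremum x y =
        M.cancel (L.trans (L.x≤x∨y ⟦ x ⟧ ⟦ y ⟧) ⟦x⟧∨⟦y⟧≲⟦x∨y⟧)
      , M.cancel (L.trans (L.y≤x∨y ⟦ x ⟧ ⟦ y ⟧) ⟦x⟧∨⟦y⟧≲⟦x∨y⟧)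
      , λ z x≲z y≲z →
          M.cancel (L.trans (L.reflexive (∨-homo x y)) (L.∨-least (M.mono x≲z) (M.mono y≲z)))
      where ⟦x⟧∨⟦y⟧≲⟦x∨y⟧ = L.reflexive (L.Eq.sym (∨-homo x y))

    infimum : Infimum _≲₁_ _∧₁_
    infimum x y =
        M.cancel (L.trans ⟦x∧y⟧≲⟦x⟧∧⟦y⟧ (L.x∧y≤x ⟦ x ⟧ ⟦ y ⟧))
      , M.cancel (L.trans ⟦x∧y⟧≲⟦x⟧∧⟦y⟧ (L.x∧y≤y ⟦ x ⟧ ⟦ y ⟧))
      , λ z z≲x z≲y →
          M.cancel (L.trans (L.∧-greatest (M.mono z≲x) (M.mono z≲y)) (L.reflexive (L.Eq.sym (∧-homo x y))))
      where ⟦x∧y⟧≲⟦x⟧∧⟦y⟧ = L.reflexive (∧-homo x y)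

⊓-⊔-≥-isDistributiveLattice : IsDistributiveLattice _≡_ _≥_ _⊓_ _⊔_
⊓-⊔-≥-isDistributiveLattice = record
  { isLattice = record
    { isPartialOrder = ≥-isPartialOrder
    ; supremum       = λ x y → m⊓n≤m x y , m⊓n≤n x y , λ _ → ⊓-glb
    ; infimum        = λ x y → m≤m⊔n x y , m≤n⊔m x y , λ _ → ⊔-lub
    }
  ; ∧-distribˡ-∨ = ⊔-distribˡ-⊓
  }

sum-replicate : ∀ c x → sum (replicate c x) ≡ c * x
sum-replicate zero    x = refl
sum-replicate (suc c) x = cong (x +_) (sum-replicate c x)

sum<⇒All< : ∀ {T} xs → sum xs < T → All (_< T) xs
sum<⇒All< []       _   = []
sum<⇒All< (x ∷ xs) Σ<T =
  ≤-<-trans (m≤m+n x (sum xs)) Σ<T ∷ sum<⇒All< xs (≤-<-trans (m≤n+m (sum xs) x) Σ<T)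

sumBelow : ℕ → List ℕ → ℕ
sumBelow T xs = sum (filter (_<? T) xs)

sumBelow-++ : ∀ T xs ys → sumBelow T (xs ++ ys) ≡ sumBelow T xs + sumBelow T ys
sumBelow-++ T xs ys =
  trans (cong sum (filter-++ (_<? T) xs ys)) (sum-++ (filter (_<? T) xs) (filter (_<? T) ys))

sumBelow-↭ : ∀ T {xs ys} → xs ↭ ys → sumBelow T xs ≡ sumBelow T ys
sumBelow-↭ T xs↭ys = sum-↭ (filter-↭ (_<? T) xs↭ys)

sumBelow-all : ∀ {T xs} → All (_< T) xs → sumBelow T xs ≡ sum xs
sumBelow-all {T} xs<T = cong sum (filter-all (_<? T) xs<T)

sumBelow-none : ∀ {T xs} → All (T ≤_) xs → sumBelow T xs ≡ 0
sumBelow-none {T} T≤xs = cong sum (filter-none (_<? T) (All.map ≤⇒≯ T≤xs))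

-- A block whose sum lies below T consists of parts below T.
sumBelow-concat : ∀ T bs → sumBelow T (map sum bs) ≤ sumBelow T (concat bs)
sumBelow-concat T [] = z≤n
sumBelow-concat T (B ∷ bs) with sum B <? T
... | yes ΣB<T = begin
  sumBelow T (sum B ∷ map sum bs)       ≡⟨ cong sum (filter-accept (_<? T) ΣB<T) ⟩
  sum B + sumBelow T (map sum bs)       ≤⟨ +-monoʳ-≤ (sum B) (sumBelow-concat T bs) ⟩
  sum B + sumBelow T (concat bs)        ≡⟨ cong (_+ _) (sumBelow-all (sum<⇒All< B ΣB<T)) ⟨
  sumBelow T B + sumBelow T (concat bs) ≡⟨ sumBelow-++ T B (concat bs) ⟨
  sumBelow T (B ++ concat bs)           ∎
  where open ≤-Reasoning
... | no ΣB≮T = begin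
  sumBelow T (sum B ∷ map sum bs)       ≡⟨ cong sum (filter-reject (_<? T) ΣB≮T) ⟩
  sumBelow T (map sum bs)               ≤⟨ sumBelow-concat T bs ⟩
  sumBelow T (concat bs)                ≤⟨ m≤n+m _ (sumBelow T B) ⟩
  sumBelow T B + sumBelow T (concat bs) ≡⟨ sumBelow-++ T B (concat bs) ⟨
  sumBelow T (B ++ concat bs)           ∎
  where open ≤-Reasoning

refines⇒sumBelow-≥ : ∀ T {μ λ′} → μ refines λ′ → sumBelow T λ′ ≤ sumBelow T μ
refines⇒sumBelow-≥ T {μ} {λ′} (bs , concat↭μ , sums↭λ) = begin
  sumBelow T λ′           ≡⟨ sumBelow-↭ T sums↭λ ⟨
  sumBelow T (map sum bs) ≤⟨ sumBelow-concat T bs ⟩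
  sumBelow T (concat bs)  ≡⟨ sumBelow-↭ T concat↭μ ⟩
  sumBelow T μ            ∎
  where open ≤-Reasoning

refines-∷ : ∀ x {μ λ′} → μ refines λ′ → (x ∷ μ) refines (x ∷ λ′)
refines-∷ x (bs , concat↭μ , sums↭λ) =
  [ x ] ∷ bs , prep x concat↭μ , ↭-trans (↭-reflexive (cong (_∷ _) (+-identityʳ x))) (prep x sums↭λ)

refines-++ˡ : ∀ R {μ λ′} → μ refines λ′ → (R ++ μ) refines (R ++ λ′)
refines-++ˡ []      μ≤λ = μ≤λ
refines-++ˡ (x ∷ R) μ≤λ = refines-∷ x (refines-++ˡ R μ≤λ)

infix 4 _refines_plus_
_refines_plus_ : List ℕ → List ℕ → ℕ → Set
μ refines λ′ plus s = ∃₂ λ P ν → sum P ≡ s × P ++ ν ↭ μ × ν refines λ′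

refines⇒refines-plus-0 : ∀ {μ λ′} → μ refines λ′ → μ refines λ′ plus 0
refines⇒refines-plus-0 μ≤λ = [] , _ , refl , ↭-refl , μ≤λ

refines-plus-∷ : ∀ x {μ λ′ s} → μ refines λ′ plus s → (x ∷ μ) refines λ′ plus (x + s)
refines-plus-∷ x (P , ν , refl , P++ν↭μ , ν≤λ) = x ∷ P , ν , refl , prep x P++ν↭μ , ν≤λ

refines-plus-++ˡ : ∀ R {μ λ′ s} → μ refines λ′ plus s → (R ++ μ) refines (R ++ λ′) plus s
refines-plus-++ˡ R (P , ν , ΣP , P++ν↭μ , ν≤λ) =
  P , R ++ ν , ΣP , ↭-trans (shifts P R) (++⁺ˡ R P++ν↭μ) , refines-++ˡ R ν≤λ

refines-plus⇒refines : ∀ {μ λ′ s} → μ refines λ′ plus s → μ refines (s ∷ λ′)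
refines-plus⇒refines (P , ν , refl , P++ν↭μ , (bs , concat↭ν , sums↭λ)) =
  P ∷ bs , ↭-trans (++⁺ˡ P concat↭ν) P++ν↭μ , prep (sum P) sums↭λ

digit-carry : ∀ a c w A B → a * w + A ≡ c * w + B → B ≤ A → A < 2 * w →
              (c ≡ a × A ≡ B) ⊎ (c ≡ suc a × A ≡ w + B)
digit-carry zero zero w A B eq _ _ = inj₁ (refl , eq)
digit-carry zero (suc zero) w A B eq _ _ = inj₂ (refl , trans eq (cong (_+ B) (+-identityʳ w)))
digit-carry zero (suc (suc c)) w A B eq _ A<2w = contradiction 2w≤A (<⇒≱ A<2w)
  where
  2w≤A : 2 * w ≤ A
  2w≤A = ≤-trans (*-monoˡ-≤ w {2} {suc (suc c)} (s≤s (s≤s z≤n)))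
                 (≤-trans (m≤m+n _ B) (≤-reflexive (sym eq)))
digit-carry (suc a) zero zero A B eq _ ()
digit-carry (suc a) zero (suc w) A B eq B≤A _ =
  contradiction (≤-trans (≤-reflexive eq) B≤A) (<⇒≱ (m<n+m A (s≤s z≤n)))
digit-carry (suc a) (suc c) w A B eq B≤A A<2w with digit-carry a c w A B eq′ B≤A A<2w
  where eq′ = +-cancelˡ-≡ w _ _ (trans (sym (+-assoc w _ A)) (trans eq (+-assoc w _ B)))
... | inj₁ (c≡a , A≡B)     = inj₁ (cong suc c≡a , A≡B)
... | inj₂ (c≡1+a , A≡w+B) = inj₂ (cong suc c≡1+a , A≡w+B)

2*w+[b*w+B]≡[2+b]*w+B : ∀ w b B → 2 * w + (b * w + B) ≡ suc (suc b) * w + B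
2*w+[b*w+B]≡[2+b]*w+B = solve 3 (λ w b B → con 2 :* w :+ (b :* w :+ B) := (con 2 :+ b) :* w :+ B) refl
  where open +-*-Solver

EqualOrApart : ℕ → ℕ → ℕ → Set
EqualOrApart w x y = x ≡ y ⊎ x ≡ w + y ⊎ y ≡ w + x

EqualOrApart-sym : ∀ {w x y} → EqualOrApart w x y → EqualOrApart w y x
EqualOrApart-sym (inj₁ x≡y)          = inj₁ (sym x≡y)
EqualOrApart-sym (inj₂ (inj₁ x≡w+y)) = inj₂ (inj₂ x≡w+y)
EqualOrApart-sym (inj₂ (inj₂ y≡w+x)) = inj₂ (inj₁ y≡w+x)

<-tail⇒≤ : ∀ {a b A B w} → a ≤ 2 → B < 2 * w → EqualOrApart (2 * w) (a * w + A) (b * w + B) →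
           A < B → a * w + A ≤ b * w + B × B ≡ w + A
<-tail⇒≤ {a} {b} {A} {B} {w} _ B<2w (inj₁ eq) A<B
  with digit-carry b a w B A (sym eq) (<⇒≤ A<B) B<2w
... | inj₁ (_ , B≡A)   = contradiction (sym B≡A) (<⇒≢ A<B)
... | inj₂ (_ , B≡w+A) = ≤-reflexive eq , B≡w+A
<-tail⇒≤ {a} {b} {A} {B} {w} a≤2 B<2w (inj₂ (inj₁ eq)) A<B
  with digit-carry (suc (suc b)) a w B A (sym (trans eq (2*w+[b*w+B]≡[2+b]*w+B w b B))) (<⇒≤ A<B) B<2w
... | inj₁ (_ , B≡A)   = contradiction (sym B≡A) (<⇒≢ A<B)
... | inj₂ (a≡3+b , _) = contradiction (subst (_≤ 2) a≡3+b a≤2) λ { (s≤s (s≤s ())) }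
<-tail⇒≤ {a} {b} {A} {B} {w} _ B<2w (inj₂ (inj₂ eq)) A<B
  with digit-carry b (suc (suc a)) w B A (trans eq (2*w+[b*w+B]≡[2+b]*w+B w a A)) (<⇒≤ A<B) B<2w
... | inj₁ (_ , B≡A)   = contradiction (sym B≡A) (<⇒≢ A<B)
... | inj₂ (_ , B≡w+A) = ≤-trans (m≤n+m _ (2 * w)) (≤-reflexive (sym eq)) , B≡w+A

_≤lex_ : ℕ × ℕ → ℕ × ℕ → Set
_≤lex_ = ×-Lex _≡_ _<_ _≤_

≤lex-total : Total _≤lex_
≤lex-total = ×-total₂ sym <-cmp ≤-total

≤lex⇒≤ : ∀ {a b A B w} → a ≤ 2 → B < 2 * w → EqualOrApart (2 * w) (a * w + A) (b * w + B) →
         (A , a) ≤lex (B , b) → a * w + A ≤ b * w + B × A ≤ B × EqualOrApart w A B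
≤lex⇒≤ {a} {b} a≤2 B<2w apart (inj₁ A<B) with <-tail⇒≤ {a} {b} a≤2 B<2w apart A<B
... | aA≤bB , B≡w+A = aA≤bB , <⇒≤ A<B , inj₂ (inj₂ B≡w+A)
≤lex⇒≤ {w = w} _ _ _ (inj₂ (refl , a≤b)) = +-monoˡ-≤ _ (*-monoˡ-≤ w a≤b) , ≤-refl , inj₁ refl

digit≤2 : (d : Fin 3) → toℕ d ≤ 2
digit≤2 = toℕ≤pred[n]

2^k<2^suc[k] : ∀ k → 2 ^ k < 2 ^ suc k
2^k<2^suc[k] k = ^-monoʳ-< 2 (s≤s (s≤s z≤n)) (n<1+n k)

value<2^suc : ∀ {k} (w : Word k) → value w < 2 ^ suc k
value<2^suc []               = s≤s z≤n
value<2^suc {suc k} (d ∷ ds) = begin-strict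
  toℕ d * 2 ^ k + value ds ≤⟨ +-monoˡ-≤ (value ds) (*-monoˡ-≤ (2 ^ k) (digit≤2 d)) ⟩
  2 ^ suc k + value ds     <⟨ +-monoʳ-< (2 ^ suc k) (value<2^suc ds) ⟩
  2 ^ suc k + 2 ^ suc k    ≡⟨ cong (2 ^ suc k +_) (+-identityʳ (2 ^ suc k)) ⟨
  2 ^ suc (suc k)          ∎
  where open ≤-Reasoning

sum-parts : ∀ {k} (w : Word k) → sum (parts w) ≡ value w
sum-parts []               = refl
sum-parts {suc k} (d ∷ ds) = begin
  sum (replicate (toℕ d) (2 ^ k) ++ parts ds)         ≡⟨ sum-++ (replicate (toℕ d) (2 ^ k)) (parts ds) ⟩
  sum (replicate (toℕ d) (2 ^ k)) + sum (parts ds)   ≡⟨ cong₂ _+_ (sum-replicate (toℕ d) (2 ^ k)) (sum-parts ds) ⟩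
  toℕ d * 2 ^ k + value ds                           ∎
  where open ≡-Reasoning

parts< : ∀ {k} (w : Word k) → All (_< 2 ^ k) (parts w)
parts< []               = []
parts< {suc k} (d ∷ ds) =
  ++⁺ (replicate⁺ (toℕ d) (2^k<2^suc[k] k))
      (All.map (λ p<2^k → <-trans p<2^k (2^k<2^suc[k] k)) (parts< ds))

sumBelow-parts : ∀ {k T} (w : Word k) → 2 ^ k ≤ T → sumBelow T (parts w) ≡ value w
sumBelow-parts w 2^k≤T =
  trans (sumBelow-all (All.map (λ p<2^k → <-≤-trans p<2^k 2^k≤T) (parts< w))) (sum-parts w)

sumBelow-parts-∷ : ∀ {k T} d (ds : Word k) → T ≤ 2 ^ k →
                   sumBelow T (parts (d ∷ ds)) ≡ sumBelow T (parts ds)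
sumBelow-parts-∷ {k} {T} d ds T≤2^k =
  trans (sumBelow-++ T (replicate (toℕ d) (2 ^ k)) (parts ds))
        (cong (_+ sumBelow T (parts ds)) (sumBelow-none (replicate⁺ (toℕ d) T≤2^k)))

suffixValues : ∀ {k} → Word k → Vec ℕ k
suffixValues []       = []
suffixValues (d ∷ ds) = value (d ∷ ds) ∷ suffixValues ds

suffixValues-injective : ∀ {k} {X Y : Word k} → suffixValues X ≡ suffixValues Y → X ≡ Y
suffixValues-injective {X = []} {[]} _ = refl
suffixValues-injective {suc k} {a ∷ A} {b ∷ B} eq with ∷-injective eq
... | aA≡bB , sA≡sB with suffixValues-injective sA≡sB
... | refl = cong (_∷ A) (toℕ-injective
  (*-cancelʳ-≡ (toℕ a) (toℕ b) (2 ^ k) {{m^n≢0 2 k}} (+-cancelʳ-≡ (value A) _ _ aA≡bB)))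

value-zipWith : ∀ {k} {f : ℕ → ℕ → ℕ} → f 0 0 ≡ 0 → (X Y Z : Word k) →
  suffixValues Z ≡ zipWith f (suffixValues X) (suffixValues Y) → value Z ≡ f (value X) (value Y)
value-zipWith f00≡0 [] [] [] _ = sym f00≡0
value-zipWith _ (_ ∷ _) (_ ∷ _) (_ ∷ _) eq = proj₁ (∷-injective eq)

Pointwise-≥⇒value-≥ : ∀ {k} (X Y : Word k) →
  Pointwise _≥_ (suffixValues X) (suffixValues Y) → value X ≥ value Y
Pointwise-≥⇒value-≥ [] [] _ = z≤n
Pointwise-≥⇒value-≥ (_ ∷ _) (_ ∷ _) (X≥Y ∷ _) = X≥Y

-- The suffix of length j of a word carries exactly its parts below 2 ^ j.
sumBelow-≥⇒Pointwise-≥ : ∀ {k} (X Y : Word k) →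
  (∀ T → T ≤ 2 ^ k → sumBelow T (parts Y) ≤ sumBelow T (parts X)) →
  Pointwise _≥_ (suffixValues X) (suffixValues Y)
sumBelow-≥⇒Pointwise-≥ [] [] _ = []
sumBelow-≥⇒Pointwise-≥ {suc k} (a ∷ A) (b ∷ B) below = head ∷ sumBelow-≥⇒Pointwise-≥ A B tail
  where
  head : value (a ∷ A) ≥ value (b ∷ B)
  head = subst₂ _≤_ (sumBelow-parts (b ∷ B) ≤-refl) (sumBelow-parts (a ∷ A) ≤-refl) (below _ ≤-refl)

  tail : ∀ T → T ≤ 2 ^ k → sumBelow T (parts B) ≤ sumBelow T (parts A)
  tail T T≤2^k = subst₂ _≤_ (sumBelow-parts-∷ b B T≤2^k) (sumBelow-parts-∷ a A T≤2^k)
    (below T (≤-trans T≤2^k (<⇒≤ (2^k<2^suc[k] k))))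

-- Digit by digit from the top: either the digits agree, or Y has one more copy of 2 ^ k
-- and the tail of X must supply a block of that size (the carry).
Pointwise-≥⇒refines : ∀ {k} (X Y : Word k) → value X ≡ value Y →
  Pointwise _≥_ (suffixValues X) (suffixValues Y) → parts X refines parts Y
Pointwise-≥⇒refines-plus : ∀ {k} (X Y : Word k) → value X ≡ 2 ^ k + value Y →
  Pointwise _≥_ (suffixValues X) (suffixValues Y) → parts X refines parts Y plus 2 ^ k

Pointwise-≥⇒refines [] [] _ _ = [] , ↭-refl , ↭-refl
Pointwise-≥⇒refines {suc k} (a ∷ A) (b ∷ B) eq (_ ∷ A≥B)
  with digit-carry (toℕ a) (toℕ b) (2 ^ k) (value A) (value B) eq
                   (Pointwise-≥⇒value-≥ A B A≥B) (value<2^suc A)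
... | inj₁ (b≡a , A≡B) rewrite b≡a =
  refines-++ˡ (replicate (toℕ a) (2 ^ k)) (Pointwise-≥⇒refines A B A≡B A≥B)
... | inj₂ (b≡1+a , A≡2^k+B) rewrite b≡1+a =
  refines-plus⇒refines (refines-plus-++ˡ (replicate (toℕ a) (2 ^ k))
                                         (Pointwise-≥⇒refines-plus A B A≡2^k+B A≥B))

Pointwise-≥⇒refines-plus [] [] () _
Pointwise-≥⇒refines-plus {suc k} (a ∷ A) (b ∷ B) eq (_ ∷ A≥B)
  with digit-carry (toℕ a) (suc (suc (toℕ b))) (2 ^ k) (value A) (value B)
                   (trans eq (2*w+[b*w+B]≡[2+b]*w+B (2 ^ k) (toℕ b) (value B)))
                   (Pointwise-≥⇒value-≥ A B A≥B) (value<2^suc A)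
... | inj₁ (2+b≡a , A≡B) rewrite sym 2+b≡a =
  refines-plus-∷ (2 ^ k) (refines-plus-∷ (2 ^ k) (refines⇒refines-plus-0
    (refines-++ˡ (replicate (toℕ b) (2 ^ k)) (Pointwise-≥⇒refines A B A≡B A≥B))))
... | inj₂ (2+b≡1+a , A≡2^k+B) rewrite sym (suc-injective 2+b≡1+a) =
  subst (_refines_plus_ _ _) (cong (2 ^ k +_) (sym (+-identityʳ (2 ^ k))))
    (refines-plus-∷ (2 ^ k) (refines-plus-++ˡ (replicate (toℕ b) (2 ^ k))
                                              (Pointwise-≥⇒refines-plus A B A≡2^k+B A≥B)))

joinWord : ∀ {k} → Word k → Word k → Word k
joinWord []       []       = []
joinWord (a ∷ A) (b ∷ B) with ≤lex-total (value A , toℕ a) (value B , toℕ b)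
... | inj₁ _ = a ∷ joinWord A B
... | inj₂ _ = b ∷ joinWord A B

meetWord : ∀ {k} → Word k → Word k → Word k
meetWord []       []       = []
meetWord (a ∷ A) (b ∷ B) with ≤lex-total (value A , toℕ a) (value B , toℕ b)
... | inj₁ _ = b ∷ meetWord A B
... | inj₂ _ = a ∷ meetWord A B

suffixValues-∷ : ∀ {k} (f : ℕ → ℕ → ℕ) → f 0 0 ≡ 0 → (a b c : Fin 3) (X Y Z : Word k) →
  suffixValues Z ≡ zipWith f (suffixValues X) (suffixValues Y) →
  toℕ c * 2 ^ k + f (value X) (value Y) ≡ f (value (a ∷ X)) (value (b ∷ Y)) →
  suffixValues (c ∷ Z) ≡ zipWith f (suffixValues (a ∷ X)) (suffixValues (b ∷ Y))
suffixValues-∷ {k} f f00≡0 a b c X Y Z sZ≡ head≡ =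
  cong₂ _∷_ (trans (cong (toℕ c * 2 ^ k +_) (value-zipWith f00≡0 X Y Z sZ≡)) head≡) sZ≡

suffixValues-joinWord : ∀ {k} (X Y : Word k) → EqualOrApart (2 ^ k) (value X) (value Y) →
  suffixValues (joinWord X Y) ≡ zipWith _⊓_ (suffixValues X) (suffixValues Y)
suffixValues-joinWord [] [] _ = refl
suffixValues-joinWord {suc k} (a ∷ A) (b ∷ B) apart with ≤lex-total (value A , toℕ a) (value B , toℕ b)
... | inj₁ A≤ₗB with ≤lex⇒≤ {w = 2 ^ k} (digit≤2 a) (value<2^suc B) apart A≤ₗB
...   | aA≤bB , A≤B , apart′ =
  suffixValues-∷ _⊓_ refl a b a A B (joinWord A B) (suffixValues-joinWord A B apart′)
    (trans (cong (_ +_) (m≤n⇒m⊓n≡m A≤B)) (sym (m≤n⇒m⊓n≡m aA≤bB)))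
suffixValues-joinWord {suc k} (a ∷ A) (b ∷ B) apart | inj₂ B≤ₗA
  with ≤lex⇒≤ {w = 2 ^ k} (digit≤2 b) (value<2^suc A) (EqualOrApart-sym {2 ^ suc k} apart) B≤ₗA
...   | bB≤aA , B≤A , apart′ =
  suffixValues-∷ _⊓_ refl a b b A B (joinWord A B) (suffixValues-joinWord A B (EqualOrApart-sym {2 ^ k} apart′))
    (trans (cong (_ +_) (m≥n⇒m⊓n≡n B≤A)) (sym (m≥n⇒m⊓n≡n bB≤aA)))

suffixValues-meetWord : ∀ {k} (X Y : Word k) → EqualOrApart (2 ^ k) (value X) (value Y) →
  suffixValues (meetWord X Y) ≡ zipWith _⊔_ (suffixValues X) (suffixValues Y)
suffixValues-meetWord [] [] _ = refl
suffixValues-meetWord {suc k} (a ∷ A) (b ∷ B) apart with ≤lex-total (value A , toℕ a) (value B , toℕ b)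
... | inj₁ A≤ₗB with ≤lex⇒≤ {w = 2 ^ k} (digit≤2 a) (value<2^suc B) apart A≤ₗB
...   | aA≤bB , A≤B , apart′ =
  suffixValues-∷ _⊔_ refl a b b A B (meetWord A B) (suffixValues-meetWord A B apart′)
    (trans (cong (_ +_) (m≤n⇒m⊔n≡n A≤B)) (sym (m≤n⇒m⊔n≡n aA≤bB)))
suffixValues-meetWord {suc k} (a ∷ A) (b ∷ B) apart | inj₂ B≤ₗA
  with ≤lex⇒≤ {w = 2 ^ k} (digit≤2 b) (value<2^suc A) (EqualOrApart-sym {2 ^ suc k} apart) B≤ₗA
...   | bB≤aA , B≤A , apart′ =
  suffixValues-∷ _⊔_ refl a b a A B (meetWord A B) (suffixValues-meetWord A B (EqualOrApart-sym {2 ^ k} apart′))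
    (trans (cong (_ +_) (m≥n⇒m⊔n≡m B≤A)) (sym (m≥n⇒m⊔n≡m bB≤aA)))

module HyperbinaryLattice (n : ℕ) where

  ⟦_⟧ : D n → Vec ℕ (bitLength n)
  ⟦ X , _ ⟧ = suffixValues X

  same-value : (x y : D n) → value (proj₁ x) ≡ value (proj₁ y)
  same-value (_ , X≡n) (_ , Y≡n) = trans X≡n (sym Y≡n)

  ⟦∨⟧ : ∀ x y → suffixValues (joinWord (proj₁ x) (proj₁ y)) ≡ zipWith _⊓_ ⟦ x ⟧ ⟦ y ⟧
  ⟦∨⟧ x y = suffixValues-joinWord (proj₁ x) (proj₁ y) (inj₁ (same-value x y))

  ⟦∧⟧ : ∀ x y → suffixValues (meetWord (proj₁ x) (proj₁ y)) ≡ zipWith _⊔_ ⟦ x ⟧ ⟦ y ⟧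
  ⟦∧⟧ x y = suffixValues-meetWord (proj₁ x) (proj₁ y) (inj₁ (same-value x y))

  _∨_ : Op₂ (D n)
  x@(X , X≡n) ∨ y@(Y , Y≡n) = joinWord X Y , (begin
    value (joinWord X Y) ≡⟨ value-zipWith refl X Y (joinWord X Y) (⟦∨⟧ x y) ⟩
    value X ⊓ value Y    ≡⟨ cong₂ _⊓_ X≡n Y≡n ⟩
    n ⊓ n                ≡⟨ ⊓-idem n ⟩
    n                    ∎)
    where open ≡-Reasoning

  _∧_ : Op₂ (D n)
  x@(X , X≡n) ∧ y@(Y , Y≡n) = meetWord X Y , (begin
    value (meetWord X Y) ≡⟨ value-zipWith refl X Y (meetWord X Y) (⟦∧⟧ x y) ⟩
    value X ⊔ value Y    ≡⟨ cong₂ _⊔_ X≡n Y≡n ⟩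
    n ⊔ n                ≡⟨ ⊔-idem n ⟩
    n                    ∎)
    where open ≡-Reasoning

  ⟦⟧-isOrderMonomorphism : IsOrderMonomorphism _≈D_ (Pointwise _≡_) _≤D_ (Pointwise _≥_) ⟦_⟧
  ⟦⟧-isOrderMonomorphism = record
    { isOrderHomomorphism = record
      { cong = λ X≡Y → ≡⇒Pointwise-≡ (cong suffixValues X≡Y)
      ; mono = λ {x} {y} x≤y →
          sumBelow-≥⇒Pointwise-≥ (proj₁ x) (proj₁ y) (λ T _ → refines⇒sumBelow-≥ T x≤y)
      }
    ; injective = λ ⟦x⟧≡⟦y⟧ → suffixValues-injective (Pointwise-≡⇒≡ ⟦x⟧≡⟦y⟧)
    ; cancel    = λ {x} {y} → Pointwise-≥⇒refines (proj₁ x) (proj₁ y) (same-value x y)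
    }

  isDistributiveLattice : IsDistributiveLattice _≈D_ _≤D_ _∨_ _∧_
  isDistributiveLattice = pullback-isDistributiveLattice ⟦⟧-isOrderMonomorphism
    (λ x y → ≡⇒Pointwise-≡ (⟦∨⟧ x y))
    (λ x y → ≡⇒Pointwise-≡ (⟦∧⟧ x y))
    (Pointwise-isDistributiveLattice ⊓-⊔-≥-isDistributiveLattice (bitLength n))

corollary3p12 : (n : ℕ) → 1 ≤ n →
    Σ (Op₂ (D n)) (λ _∨_ → Σ (Op₂ (D n)) (λ _∧_ →
      IsDistributiveLattice (_≈D_ {n}) (_≤D_ {n}) _∨_ _∧_))
corollary3p12 n _ = _∨_ , _∧_ , isDistributiveLattice
  where open HyperbinaryLattice n
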